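{- Let $P=([n],\preceq)$ be a poset and $0\le r\le m\le n$, let $\lambda=|P^r|-r$ and let $k$ be the number of maximal elements of $\widetilde P^r$. If there is an $r$-error-correcting $P$-code $\mathcal{C}\subseteq F^n$ with $|\mathcal{C}|=2^{n-m}$ and $k\ge\lambda$, then $$2^{r+\lambda}-2^{r+\lambda-k}\sum_{\sigma=0}^{\lambda-1}\binom{k}{\sigma}\le 2^m.$$
   Context: $[n]=\{1,\dots,n\}$; subsets of $[n]$ are identified with their characteristic vectors in $F^n=\{0,1\}^n$, and $x+y$ is the symmetric difference. An ideal of $P$ is a set $I\subseteq[n]$ such that $a\in I$ and $b\preceq a$ imply $b\in I$; ${<}X{>}$ is the smallest ideal containing $X$. $\mathcal{I}_P^r$ is the set of ideals of cardinality $r$; $P^r=\bigcup_{J\in\mathcal{I}_P^r}J$ and $\widetilde P^r=P^r\setminus\bigcap_{J\in\mathcal{I}_P^r}J$ (with the induced order). The $P$-weight is $w_P(x)=|{<}x{>}|$ and $\mathcal{B}_P^r=\{x\in F^n: w_P(x)\le r\}$. A $P$-code $\mathcal{C}\subseteq F^n$ is $r$-error-correcting if every $x\in F^n$ has at most one representation $x=c+b$ with $c\in\mathcal{C}$, $b\in\mathcal{B}_P^r$. -}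

module Defs where

open import Data.Bool using (Bool; true; false; _xor_)
open import Data.Nat using (ℕ; zero; suc; _∸_; _^_; _*_; _+_)
open import Data.Nat.Properties using (m^n≢0)
open import Data.Nat.Combinatorics using (_C_)
open import Data.Fin using (Fin)
open import Data.Fin.Subset using (Subset; _∈_; ∣_∣; ⋃; ⋂; _─_)
open import Data.Fin.Subset.Properties using (_∈?_)
open import Data.Fin.Properties using (all?; any?)
open import Data.List using (List; []; _∷_; map; filter; upTo; _++_)
open import Data.Nat.ListAction using (sum)
open import Data.Vec using (Vec; []; _∷_; tabulate; zipWith)
open import Data.Product using (_×_; Σ)
open import Relation.Nullary using (Dec; does; ¬_)
open import Relation.Nullary.Decidable using (_×-dec_; _→-dec_)
open import Relation.Binary.Core using (Rel)
open import Relation.Binary.Definitions using (Decidable)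
open import Relation.Binary.Structures using (IsPartialOrder)
open import Relation.Binary.PropositionalEquality using (_≡_)
open import Data.Nat using (_≟_)
open import Data.Fin using () renaming (_≟_ to _≟ᶠ_)

record FinPoset (n : ℕ) : Set₁ where
  field
    _≼_ : Rel (Fin n) _
    isPartialOrder : IsPartialOrder _≡_ _≼_
    _≼?_ : Decidable _≼_

allSubsets : (m : ℕ) → List (Subset m)
allSubsets zero = [] ∷ []
allSubsets (suc m) = map (true ∷_) (allSubsets m) ++ map (false ∷_) (allSubsets m)

module _ {n : ℕ} (P : FinPoset n) where
  open FinPoset P

  -- vectors of F^n = {0,1}^n, identified with subsets of [n]
  F : Set
  F = Subset n

  IsIdeal : Subset n → Set
  IsIdeal I = ∀ a → a ∈ I → ∀ b → b ≼ a → b ∈ I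

  isIdeal? : (I : Subset n) → Dec (IsIdeal I)
  isIdeal? I = all? λ a → (a ∈? I) →-dec all? λ b → (b ≼? a) →-dec (b ∈? I)

  idealsOfSize : ℕ → List (Subset n)
  idealsOfSize r = filter (λ J → isIdeal? J ×-dec (∣ J ∣ ≟ r)) (allSubsets n)

  Pʳ : ℕ → Subset n
  Pʳ r = ⋃ (idealsOfSize r)

  P̃ʳ : ℕ → Subset n
  P̃ʳ r = Pʳ r ─ ⋂ (idealsOfSize r)

  IsMaximalIn : Subset n → Fin n → Set
  IsMaximalIn S a = a ∈ S × (∀ b → b ∈ S → a ≼ b → b ≡ a)

  isMaximalIn? : (S : Subset n) (a : Fin n) → Dec (IsMaximalIn S a)
  isMaximalIn? S a = (a ∈? S) ×-dec all? λ b → (b ∈? S) →-dec ((a ≼? b) →-dec (b ≟ᶠ a))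

  maximals : Subset n → Subset n
  maximals S = tabulate λ a → does (isMaximalIn? S a)

  ⟨_⟩ : Subset n → Subset n
  ⟨ x ⟩ = tabulate λ b → does (any? λ a → (a ∈? x) ×-dec (b ≼? a))

  wP : F → ℕ
  wP x = ∣ ⟨ x ⟩ ∣

  InBall : ℕ → F → Set
  InBall r x = wP x Data.Nat.≤ r

  _⊕_ : F → F → F
  _⊕_ = zipWith _xor_

  ErrorCorrecting : ℕ → (F → Set) → Set
  ErrorCorrecting r C = ∀ (x c c′ b b′ : F) → C c → C c′ → InBall r b → InBall r b′ →
    x ≡ c ⊕ b → x ≡ c′ ⊕ b′ → (c ≡ c′ × b ≡ b′)

binomSum : ℕ → ℕ → ℕ
binomSum k λ′ = sum (map (k C_) (upTo λ′))

module Submission where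

-- Let U = P^r and I = ⋂ 𝓘_P^r, both ideals, and let T be the set of maximal elements of P̃^r = U ─ I.
-- For x ⊆ U the ideal ⟨x⟩ lies in U and contains no point of T ─ x: a point of T below some a ∈ x
-- would lie in I if a ∈ I, and would equal a by maximality otherwise. Hence w_P(x) + |T ─ x| ≤ |U|,
-- so every x ⊆ U leaving at least λ points of T outside lies in 𝓑_P^r. Counting these x by their
-- trace on T gives 2^{r+λ} − 2^{r+λ−k} Σ_{σ<λ} C(k,σ) of them, and since translates of the ball by
-- codewords are disjoint, 2^{n−m} times this number is at most 2^n.

open import Defs
open import Data.Bool using (true; false)
open import Data.Empty using (⊥-elim)
open import Data.Fin using (Fin)
open import Data.Fin.Properties using (any?)
open import Data.Fin.Subset using (Subset; ∣_∣; ⋃; ⋂; _─_; _∪_; _∩_; _⊆_)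
  renaming (_∈_ to _∈ₛ_; _∉_ to _∉ₛ_)
open import Data.Fin.Subset.Properties
  using (_∈?_; out⊆; s⊆s; drop-∷-⊆; ∈⊤; ∉⊥; x∈p∪q⁺; x∈p∪q⁻; x∈p∩q⁺; x∈p∩q⁻; p─q⊆p; x∈p∧x∉q⇒x∈p─q; p⊆q⇒∣p∣≤∣q∣)
open import Data.Integer as ℤ using (+_; +≤+)
import Data.Integer.Properties as ℤ
open import Data.Integer.Properties using (pos-+; pos-*)
import Data.Integer.Tactic.RingSolver as ℤ-Solver
open import Data.List using (List; []; _∷_; [_]; map; _++_; _∷ʳ_; length; upTo; removeAt; cartesianProduct)
open import Data.List.Properties using (map-++; length-++; length-map; upTo-∷ʳ; length-removeAt′)
open import Data.List.Membership.Propositional using (_∈_)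
open import Data.List.Membership.Propositional.Properties using (∈-map⁺; ∈-map⁻; ∈-++⁺ˡ; ∈-++⁺ʳ; ∈-cartesianProduct⁻)
open import Data.List.Relation.Unary.All as All using (All; []; _∷_)
open import Data.List.Relation.Unary.All.Properties as All using (all-filter)
open import Data.List.Relation.Unary.Any using (here; there; index)
open import Data.List.Relation.Unary.AllPairs using ([]; _∷_)
open import Data.List.Relation.Binary.Disjoint.Propositional using (Disjoint)
open import Data.List.Relation.Unary.Unique.Propositional using (Unique)
import Data.List.Relation.Unary.Unique.Propositional.Properties as Unique
open import Data.Nat using (ℕ; zero; suc; _+_; _*_; _∸_; _^_; _≤_; _<_; z≤n; s≤s; NonZero; _≟_)
open import Data.Nat.Properties
open import Data.Nat.Combinatorics using (_C_; k>n⇒nCk≡0; nCk+nC[k+1]≡[n+1]C[k+1])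
open import Data.Nat.ListAction using (sum)
open import Data.Nat.ListAction.Properties using (sum-++)
open import Data.Nat.Tactic.RingSolver using (solve-∀)
open import Data.Product using (_×_; _,_; proj₁; uncurry)
import Data.Product as Product
open import Data.Rational using (_/_; _-_; toℚᵘ) renaming (_≤_ to _≤ℚ_; -_ to -ℚ_)
open import Data.Rational.Properties using (toℚᵘ-cancel-≤; toℚᵘ-homo-+; toℚᵘ-homo‿-; toℚᵘ-fromℚᵘ)
import Data.Rational.Unnormalised as ℚᵘ
import Data.Rational.Unnormalised.Properties as ℚᵘ
open import Data.Sum using (inj₁; inj₂)
open import Data.Vec as Vec using ([]; _∷_; tabulate)
open import Data.Vec.Properties using (∷-injectiveʳ; lookup∘tabulate; []=⇒lookup)
open import Function using (_∘_; id)
open import Relation.Nullary using (Dec; yes; no; does; _×-dec_)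
open import Relation.Binary.PropositionalEquality
  using (_≡_; _≢_; refl; sym; trans; cong; cong₂; subst; module ≡-Reasoning)

binomSum-suc : ∀ k j → binomSum k (suc j) ≡ binomSum k j + k C j
binomSum-suc k j = begin
  sum (map (k C_) (upTo (suc j)))         ≡⟨ cong (sum ∘ map (k C_)) (upTo-∷ʳ j) ⟨
  sum (map (k C_) (upTo j ∷ʳ j))          ≡⟨ cong sum (map-++ (k C_) (upTo j) [ j ]) ⟩
  sum (map (k C_) (upTo j) ++ [ k C j ])  ≡⟨ sum-++ (map (k C_) (upTo j)) [ k C j ] ⟩
  binomSum k j + (k C j + 0)              ≡⟨ cong (_+_ (binomSum k j)) (+-identityʳ (k C j)) ⟩
  binomSum k j + k C j                    ∎
  where open ≡-Reasoning

binomSum-0-suc : ∀ j → binomSum 0 (suc j) ≡ 1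
binomSum-0-suc zero    = refl
binomSum-0-suc (suc j) = begin
  binomSum 0 (suc (suc j))        ≡⟨ binomSum-suc 0 (suc j) ⟩
  binomSum 0 (suc j) + 0 C suc j  ≡⟨ cong₂ _+_ (binomSum-0-suc j) (k>n⇒nCk≡0 {0} {suc j} (s≤s z≤n)) ⟩
  1                               ∎
  where open ≡-Reasoning

binomSum-pascal : ∀ k j → binomSum (suc k) j ≡ binomSum k j + binomSum k (j ∸ 1)
binomSum-pascal k zero          = refl
binomSum-pascal k (suc zero)    = refl
binomSum-pascal k (suc (suc j)) = begin
  binomSum (suc k) (suc (suc j))
    ≡⟨ binomSum-suc (suc k) (suc j) ⟩
  binomSum (suc k) (suc j) + suc k C suc j
    ≡⟨ cong₂ _+_ (binomSum-pascal k (suc j)) (sym (nCk+nC[k+1]≡[n+1]C[k+1] k j)) ⟩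
  (binomSum k (suc j) + binomSum k j) + (k C j + k C suc j)
    ≡⟨ regroup (binomSum k (suc j)) (binomSum k j) (k C j) (k C suc j) ⟩
  (binomSum k (suc j) + k C suc j) + (binomSum k j + k C j)
    ≡⟨ cong₂ _+_ (binomSum-suc k (suc j)) (binomSum-suc k j) ⟨
  binomSum k (suc (suc j)) + binomSum k (suc j) ∎
  where
  open ≡-Reasoning
  regroup : ∀ a b c d → (a + b) + (c + d) ≡ (a + d) + (b + c)
  regroup = solve-∀

∈-allSubsets : ∀ {n} (x : Subset n) → x ∈ allSubsets n
∈-allSubsets []          = here refl
∈-allSubsets (true ∷ x)  = ∈-++⁺ˡ (∈-map⁺ (true ∷_) (∈-allSubsets x))
∈-allSubsets {suc n} (false ∷ x) = ∈-++⁺ʳ (map (true ∷_) (allSubsets n)) (∈-map⁺ (false ∷_) (∈-allSubsets x))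

length-map-++ : ∀ {A B : Set} (f g : A → B) (xs ys : List A) →
                length (map f xs ++ map g ys) ≡ length xs + length ys
length-map-++ f g xs ys = trans (length-++ (map f xs)) (cong₂ _+_ (length-map f xs) (length-map g ys))

length-allSubsets : ∀ n → length (allSubsets n) ≡ 2 ^ n
length-allSubsets zero    = refl
length-allSubsets (suc n) = begin
  length (map (true ∷_) (allSubsets n) ++ map (false ∷_) (allSubsets n))
    ≡⟨ length-map-++ (true ∷_) (false ∷_) (allSubsets n) (allSubsets n) ⟩
  length (allSubsets n) + length (allSubsets n)
    ≡⟨ cong (λ l → l + l) (length-allSubsets n) ⟩
  2 ^ n + 2 ^ n
    ≡⟨ cong (_+_ (2 ^ n)) (+-identityʳ (2 ^ n)) ⟨
  2 ^ suc n ∎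
  where open ≡-Reasoning

length-cartesianProduct : ∀ {A B : Set} (xs : List A) (ys : List B) →
                          length (cartesianProduct xs ys) ≡ length xs * length ys
length-cartesianProduct []       ys = refl
length-cartesianProduct (x ∷ xs) ys =
  trans (length-++ (map (x ,_) ys)) (cong₂ _+_ (length-map (x ,_) ys) (length-cartesianProduct xs ys))

module _ {A B : Set} where

  ∈-removeAt⁺ : ∀ {x y : B} {ys} (x∈ys : x ∈ ys) → y ∈ ys → y ≢ x → y ∈ removeAt ys (index x∈ys)
  ∈-removeAt⁺ (here refl) (here refl) y≢x = ⊥-elim (y≢x refl)
  ∈-removeAt⁺ (here refl) (there y∈ys) _  = y∈ys
  ∈-removeAt⁺ (there x∈ys) (here refl) _  = here refl
  ∈-removeAt⁺ (there x∈ys) (there y∈ys) y≢x = there (∈-removeAt⁺ x∈ys y∈ys y≢x)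

  injectiveOn⇒length≤ : (f : A → B) {xs : List A} {ys : List B} → Unique xs →
                        (∀ {a b} → a ∈ xs → b ∈ xs → f a ≡ f b → a ≡ b) →
                        (∀ {a} → a ∈ xs → f a ∈ ys) → length xs ≤ length ys
  injectiveOn⇒length≤ f {[]}     _              _   _    = z≤n
  injectiveOn⇒length≤ f {x ∷ xs} {ys} (x∉xs ∷ xs!) inj f[xs]⊆ys = begin
    suc (length xs)                          ≤⟨ s≤s (injectiveOn⇒length≤ f xs! inj′ f[xs]⊆ys─fx) ⟩
    suc (length (removeAt ys (index fx∈ys))) ≡⟨ length-removeAt′ ys (index fx∈ys) ⟨
    length ys                                ∎
    where
    open ≤-Reasoning
    fx∈ys : f x ∈ ys
    fx∈ys = f[xs]⊆ys (here refl)
    inj′ : ∀ {a b} → a ∈ xs → b ∈ xs → f a ≡ f b → a ≡ b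
    inj′ a∈xs b∈xs = inj (there a∈xs) (there b∈xs)
    f[xs]⊆ys─fx : ∀ {a} → a ∈ xs → f a ∈ removeAt ys (index fx∈ys)
    f[xs]⊆ys─fx a∈xs = ∈-removeAt⁺ fx∈ys (f[xs]⊆ys (there a∈xs))
      (λ fa≡fx → All.lookup x∉xs a∈xs (inj (here refl) (there a∈xs) (sym fa≡fx)))

∣p─q∣+∣q∣≡∣p∣ : ∀ {n} (p q : Subset n) → q ⊆ p → ∣ p ─ q ∣ + ∣ q ∣ ≡ ∣ p ∣
∣p─q∣+∣q∣≡∣p∣ []          []          _   = refl
∣p─q∣+∣q∣≡∣p∣ (false ∷ p) (false ∷ q) q⊆p = ∣p─q∣+∣q∣≡∣p∣ p q (drop-∷-⊆ q⊆p)
∣p─q∣+∣q∣≡∣p∣ (false ∷ p) (true ∷ q)  q⊆p with () ← q⊆p Vec.here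
∣p─q∣+∣q∣≡∣p∣ (true ∷ p)  (false ∷ q) q⊆p = cong suc (∣p─q∣+∣q∣≡∣p∣ p q (drop-∷-⊆ q⊆p))
∣p─q∣+∣q∣≡∣p∣ (true ∷ p)  (true ∷ q)  q⊆p =
  trans (+-suc ∣ p ─ q ∣ ∣ q ∣) (cong suc (∣p─q∣+∣q∣≡∣p∣ p q (drop-∷-⊆ q⊆p)))

-- The subsets x ⊆ U with j ≤ ∣ T ─ x ∣ (all of them when T ⊆ U).
subsetsMissing : ∀ {n} → Subset n → Subset n → ℕ → List (Subset n)
subsetsMissing []          []          zero    = [ [] ]
subsetsMissing []          []          (suc j) = []
subsetsMissing (false ∷ U) (false ∷ T) j = map (false ∷_) (subsetsMissing U T j)
subsetsMissing (false ∷ U) (true ∷ T)  j = map (false ∷_) (subsetsMissing U T (j ∸ 1))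
subsetsMissing (true ∷ U)  (false ∷ T) j =
  map (true ∷_) (subsetsMissing U T j) ++ map (false ∷_) (subsetsMissing U T j)
subsetsMissing (true ∷ U)  (true ∷ T)  j =
  map (true ∷_) (subsetsMissing U T j) ++ map (false ∷_) (subsetsMissing U T (j ∸ 1))

∸1≤⇒≤suc : ∀ {j m} → j ∸ 1 ≤ m → j ≤ suc m
∸1≤⇒≤suc {zero}  _ = z≤n
∸1≤⇒≤suc {suc j}   = s≤s

subsetsMissing-sound : ∀ {n} (U T : Subset n) j →
                       All (λ x → x ⊆ U × j ≤ ∣ T ─ x ∣) (subsetsMissing U T j)
subsetsMissing-sound []          []          zero    = ((λ ()) , z≤n) ∷ []
subsetsMissing-sound []          []          (suc j) = []
subsetsMissing-sound (false ∷ U) (false ∷ T) j =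
  All.map⁺ (All.map (Product.map out⊆ id) (subsetsMissing-sound U T j))
subsetsMissing-sound (false ∷ U) (true ∷ T)  j =
  All.map⁺ (All.map (Product.map out⊆ ∸1≤⇒≤suc) (subsetsMissing-sound U T (j ∸ 1)))
subsetsMissing-sound (true ∷ U)  (false ∷ T) j = All.++⁺
  (All.map⁺ (All.map (Product.map s⊆s id) (subsetsMissing-sound U T j)))
  (All.map⁺ (All.map (Product.map out⊆ id) (subsetsMissing-sound U T j)))
subsetsMissing-sound (true ∷ U)  (true ∷ T)  j = All.++⁺
  (All.map⁺ (All.map (Product.map s⊆s id) (subsetsMissing-sound U T j)))
  (All.map⁺ (All.map (Product.map out⊆ ∸1≤⇒≤suc) (subsetsMissing-sound U T (j ∸ 1))))

true∷-false∷-disjoint : ∀ {n} (xs ys : List (Subset n)) → Disjoint (map (true ∷_) xs) (map (false ∷_) ys)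
true∷-false∷-disjoint xs ys (x∈ , x∈′)
  with _ , _ , refl ← ∈-map⁻ (true ∷_) x∈
  with _ , _ , () ← ∈-map⁻ (false ∷_) x∈′

subsetsMissing-unique : ∀ {n} (U T : Subset n) j → Unique (subsetsMissing U T j)
subsetsMissing-unique []          []          zero    = [] ∷ []
subsetsMissing-unique []          []          (suc j) = []
subsetsMissing-unique (false ∷ U) (false ∷ T) j = Unique.map⁺ ∷-injectiveʳ (subsetsMissing-unique U T j)
subsetsMissing-unique (false ∷ U) (true ∷ T)  j = Unique.map⁺ ∷-injectiveʳ (subsetsMissing-unique U T (j ∸ 1))
subsetsMissing-unique (true ∷ U)  (false ∷ T) j = Unique.++⁺
  (Unique.map⁺ ∷-injectiveʳ (subsetsMissing-unique U T j))
  (Unique.map⁺ ∷-injectiveʳ (subsetsMissing-unique U T j))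
  (true∷-false∷-disjoint _ _)
subsetsMissing-unique (true ∷ U)  (true ∷ T)  j = Unique.++⁺
  (Unique.map⁺ ∷-injectiveʳ (subsetsMissing-unique U T j))
  (Unique.map⁺ ∷-injectiveʳ (subsetsMissing-unique U T (j ∸ 1)))
  (true∷-false∷-disjoint _ _)

length-subsetsMissing : ∀ {n} (U T : Subset n) j → T ⊆ U →
  length (subsetsMissing U T j) + 2 ^ ∣ U ─ T ∣ * binomSum ∣ T ∣ j ≡ 2 ^ ∣ U ∣
length-subsetsMissing []          []          zero    _   = refl
length-subsetsMissing []          []          (suc j) _   = cong (_+ 0) (binomSum-0-suc j)
length-subsetsMissing (false ∷ U) (false ∷ T) j       T⊆U =
  trans (cong (_+ 2 ^ ∣ U ─ T ∣ * binomSum ∣ T ∣ j) (length-map (false ∷_) (subsetsMissing U T j)))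
        (length-subsetsMissing U T j (drop-∷-⊆ T⊆U))
length-subsetsMissing (false ∷ U) (true ∷ T)  j       T⊆U with () ← T⊆U Vec.here
length-subsetsMissing (true ∷ U)  (false ∷ T) j       T⊆U = begin
  length (map (true ∷_) S ++ map (false ∷_) S) + 2 ^ suc e * B
    ≡⟨ cong (_+ 2 ^ suc e * B) (length-map-++ _ _ S S) ⟩
  (length S + length S) + (2 * 2 ^ e) * B
    ≡⟨ double (length S) (2 ^ e) B ⟩
  2 * (length S + 2 ^ e * B)
    ≡⟨ cong (2 *_) (length-subsetsMissing U T j (drop-∷-⊆ T⊆U)) ⟩
  2 * 2 ^ ∣ U ∣ ∎
  where
  open ≡-Reasoning
  S = subsetsMissing U T j
  e = ∣ U ─ T ∣
  B = binomSum ∣ T ∣ j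
  double : ∀ l a b → (l + l) + (2 * a) * b ≡ 2 * (l + a * b)
  double = solve-∀
length-subsetsMissing (true ∷ U)  (true ∷ T)  j       T⊆U = begin
  length (map (true ∷_) S ++ map (false ∷_) S′) + E * binomSum (suc t) j
    ≡⟨ cong₂ _+_ (length-map-++ _ _ S S′) (cong (E *_) (binomSum-pascal t j)) ⟩
  (length S + length S′) + E * (binomSum t j + binomSum t (j ∸ 1))
    ≡⟨ distribute (length S) (length S′) E (binomSum t j) (binomSum t (j ∸ 1)) ⟩
  (length S + E * binomSum t j) + (length S′ + E * binomSum t (j ∸ 1))
    ≡⟨ cong₂ _+_ (length-subsetsMissing U T j T⊆U′) (length-subsetsMissing U T (j ∸ 1) T⊆U′) ⟩
  2 ^ ∣ U ∣ + 2 ^ ∣ U ∣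
    ≡⟨ cong (_+_ (2 ^ ∣ U ∣)) (+-identityʳ (2 ^ ∣ U ∣)) ⟨
  2 * 2 ^ ∣ U ∣ ∎
  where
  open ≡-Reasoning
  S = subsetsMissing U T j
  S′ = subsetsMissing U T (j ∸ 1)
  E = 2 ^ ∣ U ─ T ∣
  t = ∣ T ∣
  T⊆U′ = drop-∷-⊆ T⊆U
  distribute : ∀ l l′ a b b′ → (l + l′) + a * (b + b′) ≡ (l + a * b) + (l′ + a * b′)
  distribute = solve-∀

∈-tabulate⁻ : ∀ {n} {Q : Fin n → Set} (Q? : ∀ i → Dec (Q i)) {i} → i ∈ₛ tabulate (does ∘ Q?) → Q i
∈-tabulate⁻ Q? {i} i∈ with Q? i | trans (sym (lookup∘tabulate (does ∘ Q?) i)) ([]=⇒lookup i∈)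
... | yes q | _ = q
... | no _  | ()

x∈p─q⇒x∉q : ∀ {n} {p q : Subset n} {x} → x ∈ₛ p ─ q → x ∉ₛ q
x∈p─q⇒x∉q {p = _ ∷ p} {false ∷ q} Vec.here       ()
x∈p─q⇒x∉q {p = _ ∷ p} {true ∷ q}  ()             Vec.here
x∈p─q⇒x∉q {p = _ ∷ p} {_ ∷ q}     (Vec.there x∈) (Vec.there x∈q) = x∈p─q⇒x∉q x∈ x∈q

module _ {n : ℕ} (P : FinPoset n) where
  open FinPoset P

  ∪-isIdeal : ∀ {I J} → IsIdeal P I → IsIdeal P J → IsIdeal P (I ∪ J)
  ∪-isIdeal {I} {J} I↓ J↓ a a∈I∪J b b≼a with x∈p∪q⁻ I J a∈I∪J
  ... | inj₁ a∈I = x∈p∪q⁺ (inj₁ (I↓ a a∈I b b≼a))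
  ... | inj₂ a∈J = x∈p∪q⁺ (inj₂ (J↓ a a∈J b b≼a))

  ∩-isIdeal : ∀ {I J} → IsIdeal P I → IsIdeal P J → IsIdeal P (I ∩ J)
  ∩-isIdeal {I} {J} I↓ J↓ a a∈I∩J b b≼a with a∈I , a∈J ← x∈p∩q⁻ I J a∈I∩J =
    x∈p∩q⁺ (I↓ a a∈I b b≼a , J↓ a a∈J b b≼a)

  ⋃-isIdeal : ∀ {Is} → All (IsIdeal P) Is → IsIdeal P (⋃ Is)
  ⋃-isIdeal []         a a∈⊥ = ⊥-elim (∉⊥ a∈⊥)
  ⋃-isIdeal (I↓ ∷ Is↓) = ∪-isIdeal I↓ (⋃-isIdeal Is↓)

  ⋂-isIdeal : ∀ {Is} → All (IsIdeal P) Is → IsIdeal P (⋂ Is)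
  ⋂-isIdeal []         _ _ _ _ = ∈⊤
  ⋂-isIdeal (I↓ ∷ Is↓) = ∩-isIdeal I↓ (⋂-isIdeal Is↓)

  idealsOfSize-isIdeal : ∀ r → All (IsIdeal P) (idealsOfSize P r)
  idealsOfSize-isIdeal r = All.map proj₁ (all-filter (λ J → isIdeal? P J ×-dec (∣ J ∣ ≟ r)) (allSubsets n))

  maximals⊆ : ∀ S → maximals P S ⊆ S
  maximals⊆ S a∈ = proj₁ (∈-tabulate⁻ (isMaximalIn? P S) a∈)

  maximals[U─I]⊆U : ∀ U I → maximals P (U ─ I) ⊆ U
  maximals[U─I]⊆U U I = p─q⊆p U I ∘ maximals⊆ (U ─ I)

  ⟨x⟩⊆U─[maximals[U─I]─x] : ∀ {U I x} → IsIdeal P U → IsIdeal P I → x ⊆ U →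
                             ⟨_⟩ P x ⊆ U ─ (maximals P (U ─ I) ─ x)
  ⟨x⟩⊆U─[maximals[U─I]─x] {U} {I} {x} U↓ I↓ x⊆U {b} b∈⟨x⟩
    with a , a∈x , b≼a ← ∈-tabulate⁻ (λ b → any? λ a → (a ∈? x) ×-dec (b ≼? a)) b∈⟨x⟩ =
    x∈p∧x∉q⇒x∈p─q (U↓ a (x⊆U a∈x) b b≼a) b∉T─x
    where
    b∉T─x : b ∉ₛ maximals P (U ─ I) ─ x
    b∉T─x b∈T─x with b∈U─I , b-maximal ← ∈-tabulate⁻ (isMaximalIn? P (U ─ I)) (p─q⊆p _ x b∈T─x)
                  with a ∈? I
    ... | yes a∈I = x∈p─q⇒x∉q b∈U─I (I↓ a a∈I b b≼a)
    ... | no  a∉I = x∈p─q⇒x∉q b∈T─x (subst (_∈ₛ x) a≡b a∈x)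
      where
      a≡b = b-maximal a (x∈p∧x∉q⇒x∈p─q (x⊆U a∈x) a∉I) b≼a

  wP+∣T─x∣≤∣U∣ : ∀ {U I x} → IsIdeal P U → IsIdeal P I → x ⊆ U →
                 wP P x + ∣ maximals P (U ─ I) ─ x ∣ ≤ ∣ U ∣
  wP+∣T─x∣≤∣U∣ {U} {I} {x} U↓ I↓ x⊆U = begin
    wP P x + ∣ T─x ∣
      ≤⟨ +-monoˡ-≤ ∣ T─x ∣ (p⊆q⇒∣p∣≤∣q∣ (⟨x⟩⊆U─[maximals[U─I]─x] U↓ I↓ x⊆U)) ⟩
    ∣ U ─ T─x ∣ + ∣ T─x ∣
      ≡⟨ ∣p─q∣+∣q∣≡∣p∣ U T─x (maximals[U─I]⊆U U I ∘ p─q⊆p _ x) ⟩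
    ∣ U ∣ ∎
    where
    open ≤-Reasoning
    T─x = maximals P (U ─ I) ─ x

  sphere-packing : ∀ {r} {𝒞 S : List (F P)} → Unique 𝒞 → Unique S →
                   ErrorCorrecting P r (_∈ 𝒞) → All (InBall P r) S →
                   length 𝒞 * length S ≤ 2 ^ n
  sphere-packing {𝒞 = 𝒞} {S} 𝒞! S! correcting S⊆ball = begin
    length 𝒞 * length S            ≡⟨ length-cartesianProduct 𝒞 S ⟨
    length (cartesianProduct 𝒞 S)  ≤⟨ injectiveOn⇒length≤ (uncurry (_⊕_ P)) (Unique.cartesianProduct⁺ 𝒞! S!)
                                        decode (λ _ → ∈-allSubsets _) ⟩
    length (allSubsets n)          ≡⟨ length-allSubsets n ⟩
    2 ^ n                          ∎
    where
    open ≤-Reasoning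
    decode : ∀ {p q} → p ∈ cartesianProduct 𝒞 S → q ∈ cartesianProduct 𝒞 S →
             uncurry (_⊕_ P) p ≡ uncurry (_⊕_ P) q → p ≡ q
    decode {c , b} {c′ , b′} p∈ q∈ eq
      with c∈𝒞 , b∈S ← ∈-cartesianProduct⁻ 𝒞 S p∈
      with c′∈𝒞 , b′∈S ← ∈-cartesianProduct⁻ 𝒞 S q∈
      with refl , refl ← correcting (_⊕_ P c b) c c′ b b′ c∈𝒞 c′∈𝒞
                           (All.lookup S⊆ball b∈S) (All.lookup S⊆ball b′∈S) refl eq
      = refl

  code-bound : ∀ {U I r m j} → IsIdeal P U → IsIdeal P I → ∣ U ∣ ≤ r + j → m ≤ n →
               (𝒞 : List (F P)) → Unique 𝒞 → length 𝒞 ≡ 2 ^ (n ∸ m) → ErrorCorrecting P r (_∈ 𝒞) →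
               2 ^ ∣ U ∣ ≤ 2 ^ m + 2 ^ ∣ U ─ maximals P (U ─ I) ∣ * binomSum ∣ maximals P (U ─ I) ∣ j
  code-bound {U} {I} {r} {m} {j} U↓ I↓ ∣U∣≤r+j m≤n 𝒞 𝒞! ∣𝒞∣ correcting = begin
    2 ^ ∣ U ∣                        ≡⟨ length-subsetsMissing U T j (maximals[U─I]⊆U U I) ⟨
    length S + 2 ^ ∣ U ─ T ∣ * B     ≤⟨ +-monoˡ-≤ (2 ^ ∣ U ─ T ∣ * B) (*-cancelˡ-≤ (2 ^ (n ∸ m)) packed) ⟩
    2 ^ m + 2 ^ ∣ U ─ T ∣ * B        ∎
    where
    open ≤-Reasoning
    T = maximals P (U ─ I)
    S = subsetsMissing U T j
    B = binomSum ∣ T ∣ j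
    instance _ = m^n≢0 2 (n ∸ m)
    inBall : ∀ {x} → x ⊆ U × j ≤ ∣ T ─ x ∣ → InBall P r x
    inBall {x} (x⊆U , j≤∣T─x∣) = +-cancelʳ-≤ j (wP P x) r (begin
      wP P x + j            ≤⟨ +-monoʳ-≤ (wP P x) j≤∣T─x∣ ⟩
      wP P x + ∣ T ─ x ∣    ≤⟨ wP+∣T─x∣≤∣U∣ U↓ I↓ x⊆U ⟩
      ∣ U ∣                 ≤⟨ ∣U∣≤r+j ⟩
      r + j                 ∎)
    packed : 2 ^ (n ∸ m) * length S ≤ 2 ^ (n ∸ m) * 2 ^ m
    packed = begin
      2 ^ (n ∸ m) * length S ≡⟨ cong (_* length S) ∣𝒞∣ ⟨
      length 𝒞 * length S    ≤⟨ sphere-packing 𝒞! (subsetsMissing-unique U T j) correcting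
                                  (All.map inBall (subsetsMissing-sound U T j)) ⟩
      2 ^ n                  ≡⟨ cong (2 ^_) (m∸n+n≡m m≤n) ⟨
      2 ^ (n ∸ m + m)        ≡⟨ ^-distribˡ-+-* 2 (n ∸ m) m ⟩
      2 ^ (n ∸ m) * 2 ^ m    ∎

integer-minus-fraction≤ : ∀ A D K M .{{_ : NonZero K}} → A * K ≤ M * K + D → (+ A) / 1 - (+ D) / K ≤ℚ (+ M) / 1
integer-minus-fraction≤ A D (suc K′) M AK≤MK+D = toℚᵘ-cancel-≤
  (ℚᵘ.≤-respˡ-≃ (ℚᵘ.≃-sym lhs≃) (ℚᵘ.≤-respʳ-≃ (ℚᵘ.≃-sym (toℚᵘ-fromℚᵘ q)) (ℚᵘ.*≤* cross)))
  where
  K = suc K′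
  a = ℚᵘ.mkℚᵘ (+ A) 0
  d = ℚᵘ.mkℚᵘ (+ D) K′
  p = a ℚᵘ.- d
  q = ℚᵘ.mkℚᵘ (+ M) 0
  lhs≃ : toℚᵘ ((+ A) / 1 - (+ D) / K) ℚᵘ.≃ p
  lhs≃ = ℚᵘ.≃-trans (toℚᵘ-homo-+ ((+ A) / 1) (-ℚ ((+ D) / K)))
           (ℚᵘ.+-cong (toℚᵘ-fromℚᵘ a) (ℚᵘ.≃-trans (toℚᵘ-homo‿- ((+ D) / K)) (ℚᵘ.-‿cong (toℚᵘ-fromℚᵘ d))))
  cross : ℚᵘ.↥ p ℤ.* ℚᵘ.↧ q ℤ.≤ ℚᵘ.↥ q ℤ.* ℚᵘ.↧ p
  cross = begin
    (+ A ℤ.* + K ℤ.+ ℤ.- (+ D) ℤ.* + 1) ℤ.* + 1  ≡⟨ drop-units (+ A) (+ K) (+ D) ⟩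
    + A ℤ.* + K ℤ.- + D                         ≡⟨ cong (ℤ._- + D) (pos-* A K) ⟨
    + (A * K) ℤ.- + D                           ≤⟨ ℤ.+-monoˡ-≤ (ℤ.- + D) (+≤+ AK≤MK+D) ⟩
    + (M * K + D) ℤ.- + D                       ≡⟨ cong (ℤ._- + D) (pos-+ (M * K) D) ⟩
    + (M * K) ℤ.+ + D ℤ.- + D                   ≡⟨ add-sub (+ (M * K)) (+ D) ⟩
    + (M * K)                                   ≡⟨ pos-* M K ⟩
    + M ℤ.* + K                                 ≡⟨ cong (λ k → + M ℤ.* + k) (*-identityˡ K) ⟨
    + M ℤ.* + (1 * K)                           ∎
    where
    open ℤ.≤-Reasoning
    drop-units : ∀ a k d → (a ℤ.* k ℤ.+ ℤ.- d ℤ.* ℤ.1ℤ) ℤ.* ℤ.1ℤ ≡ a ℤ.* k ℤ.- d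
    drop-units = ℤ-Solver.solve-∀
    add-sub : ∀ a d → a ℤ.+ d ℤ.- d ≡ a
    add-sub = ℤ-Solver.solve-∀

clear-denominator : ∀ A E K M B → A ≡ E * K → A ≤ M + E * B → A * K ≤ M * K + A * B
clear-denominator A E K M B refl A≤M+EB = begin
  A * K                 ≤⟨ *-monoˡ-≤ K A≤M+EB ⟩
  (M + E * B) * K       ≡⟨ expand M E B K ⟩
  M * K + (E * K) * B   ∎
  where
  open ≤-Reasoning
  expand : ∀ m e b k → (m + e * b) * k ≡ m * k + (e * k) * b
  expand = solve-∀

lemma7 : (n : ℕ) (P : FinPoset n) (r m : ℕ) → r ≤ m → m ≤ n →
  (C : List (F P)) → Unique C → length C ≡ 2 ^ (n ∸ m) →
  ErrorCorrecting P r (λ c → c ∈ C) →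
  let λ′ = ∣ Pʳ P r ∣ ∸ r
      k = ∣ maximals P (P̃ʳ P r) ∣
  in λ′ ≤ k →
  ((+ (2 ^ (r + λ′))) / 1) - ((+ (2 ^ (r + λ′) * binomSum k λ′)) / (2 ^ k)) {{m^n≢0 2 k}}
    ≤ℚ ((+ (2 ^ m)) / 1)
lemma7 n P r m r≤m m≤n 𝒞 𝒞! ∣𝒞∣ correcting _ =
  integer-minus-fraction≤ (2 ^ (r + λ′)) (2 ^ (r + λ′) * binomSum k λ′) (2 ^ k) (2 ^ m) {{m^n≢0 2 k}} (cleared λ′ refl)
  where
  U = Pʳ P r
  I = ⋂ (idealsOfSize P r)
  T = maximals P (U ─ I)
  k = ∣ T ∣
  λ′ = ∣ U ∣ ∸ r
  cleared : ∀ j → λ′ ≡ j → 2 ^ (r + j) * 2 ^ k ≤ 2 ^ m * 2 ^ k + 2 ^ (r + j) * binomSum k j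
  cleared zero    _  = ≤-trans (*-monoˡ-≤ (2 ^ k) (^-monoʳ-≤ 2 (subst (_≤ m) (sym (+-identityʳ r)) r≤m)))
                               (m≤m+n _ _)
  cleared (suc l) eq = clear-denominator (2 ^ (r + suc l)) (2 ^ ∣ U ─ T ∣) (2 ^ k) (2 ^ m) (binomSum k (suc l))
                         A≡E*K A≤M+E*B
    where
    r<∣U∣ : r < ∣ U ∣
    r<∣U∣ = m∸n≢0⇒n<m (λ λ′≡0 → 1+n≢0 (trans (sym eq) λ′≡0))
    ∣U∣≡r+λ′ : ∣ U ∣ ≡ r + suc l
    ∣U∣≡r+λ′ = trans (sym (m+[n∸m]≡n (<⇒≤ r<∣U∣))) (cong (_+_ r) eq)
    A≡E*K : 2 ^ (r + suc l) ≡ 2 ^ ∣ U ─ T ∣ * 2 ^ k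
    A≡E*K = begin
      2 ^ (r + suc l)          ≡⟨ cong (2 ^_) ∣U∣≡r+λ′ ⟨
      2 ^ ∣ U ∣                ≡⟨ cong (2 ^_) (∣p─q∣+∣q∣≡∣p∣ U T (maximals[U─I]⊆U P U I)) ⟨
      2 ^ (∣ U ─ T ∣ + k)      ≡⟨ ^-distribˡ-+-* 2 ∣ U ─ T ∣ k ⟩
      2 ^ ∣ U ─ T ∣ * 2 ^ k    ∎
      where open ≡-Reasoning
    A≤M+E*B : 2 ^ (r + suc l) ≤ 2 ^ m + 2 ^ ∣ U ─ T ∣ * binomSum k (suc l)
    A≤M+E*B = subst (λ a → 2 ^ a ≤ 2 ^ m + 2 ^ ∣ U ─ T ∣ * binomSum k (suc l)) ∣U∣≡r+λ′
      (code-bound P (⋃-isIdeal P (idealsOfSize-isIdeal P r)) (⋂-isIdeal P (idealsOfSize-isIdeal P r))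
        (≤-reflexive ∣U∣≡r+λ′) m≤n 𝒞 𝒞! ∣𝒞∣ correcting)
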